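{- Let $n$ be odd, let $r$ be an integer with $0<r<\lfloor n/2\rfloor$, and fix $\ell\in[n]$; let $v=\epsilon_{\{\ell,\ell+r\}}$ (indices modulo $n$). Let $S$ be the set of $(n-1)$-dimensional simplices $\sigma$ of $\nabla_{n,2}$ such that all vertices of $\sigma$ are $r$-stable, at least one vertex of $\sigma$ is not $(r+1)$-stable, and $v$ is a vertex of $\sigma$. For $\sigma\in S$, traverse its minimal circuit in $G_{n,2}$ starting at $v$; call the $1$ initially in position $\ell$ the left $1$ and the one initially in position $\ell+r$ the right $1$, so each edge of the circuit moves either the left $1$ (a left move) or the right $1$ (a right move). Let $\lambda_i$ be the number of left moves occurring after the $i$-th right move and before the $(i+1)$-st right move. Then $\sigma\mapsto\lambda(\sigma)=(\lambda_1,\dots,\lambda_{n-r-1})$ is a bijection from $S$ onto the set of sequences of nonnegative integers $(\lambda_1,\dots,\lambda_{n-r-1})$ with $\sum_j\lambda_j=r$ and $$i+1+2r-n\le\sum_{j=1}^i\lambda_j\le i\quad\text{for all } i=1,\dots,n-r-1.$$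
   Context: $\epsilon_I\in\{0,1\}^n$ is the characteristic vector of $I\subseteq[n]$, $\Delta_{n,2}=\mathrm{conv}\{\epsilon_I:|I|=2\}$. $\mathrm{cd}(i,j)$ is the circular distance (number of edges of the shortest path between $i$ and $j$ on an $n$-cycle with vertices $1,\dots,n$ in cyclic order); a vertex $\epsilon_{\{i,j\}}$ is $r$-stable if $\mathrm{cd}(i,j)\ge r$. $G_{n,2}$ is the directed graph on the vertices $\epsilon_I$, $|I|=2$, with an edge $\epsilon\to\epsilon'$ whenever, for some $i$ (indices modulo $n$), $(\epsilon_i,\epsilon_{i+1})=(1,0)$ and $\epsilon'$ is obtained from $\epsilon$ by swapping $\epsilon_i,\epsilon_{i+1}$ (moving a $1$ one step to the right cyclically into an empty position). A minimal circuit is a directed cycle of minimal length; these have length $n$ (each $1$ moves into the initial position of the other). The circuit triangulation $\nabla_{n,2}$ of $\Delta_{n,2}$ (Lam–Postnikov) has as its $(n-1)$-dimensional simplices exactly the convex hulls of the vertex sets of the minimal circuits of $G_{n,2}$, each simplex corresponding to a unique minimal circuit. -}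

module Defs where

open import Data.Bool using (Bool; true; false; if_then_else_; _∨_)
open import Data.Nat using (ℕ; zero; suc; _+_; _*_; _∸_; _≤_; _⊓_; ∣_-_∣; NonZero)
open import Data.Nat.DivMod using (_mod_)
open import Data.Fin using (Fin; toℕ; _≟_)
open import Data.Fin.Subset using (Subset; ∣_∣; ⁅_⁆; _∪_)
open import Data.Vec using (Vec; lookup; tabulate; toList)
open import Data.List using (List; []; _∷_; map; upTo; take)
open import Data.Nat.ListAction using (sum)
open import Data.Product using (Σ; ∃; _×_)
open import Relation.Nullary using (¬_; does)
open import Relation.Binary.PropositionalEquality using (_≡_; _≢_)

-- Positions are 0,…,n-1 (0-indexed version of [n]); indices modulo n.
module _ (n : ℕ) .{{_ : NonZero n}} where

  pos : ℕ → Fin n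
  pos k = k mod n

  succ : Fin n → Fin n
  succ i = pos (suc (toℕ i))

  ε2 : Fin n → Fin n → Subset n
  ε2 i j = ⁅ i ⁆ ∪ ⁅ j ⁆

  IsVertex : Subset n → Set
  IsVertex ε = ∣ ε ∣ ≡ 2

  cd : Fin n → Fin n → ℕ
  cd i j = ∣ toℕ i - toℕ j ∣ ⊓ (n ∸ ∣ toℕ i - toℕ j ∣)

  Stable : ℕ → Subset n → Set
  Stable r ε = ∀ i j → i ≢ j → lookup ε i ≡ true → lookup ε j ≡ true → r ≤ cd i j

  swapAt : Subset n → Fin n → Subset n
  swapAt ε i = tabulate λ k →
    if does (k ≟ i) then lookup ε (succ i)
    else if does (k ≟ succ i) then lookup ε i
    else lookup ε k

  Edge : Subset n → Subset n → Set
  Edge ε ε' = ∃ λ i → lookup ε i ≡ true × lookup ε (succ i) ≡ false × ε' ≡ swapAt ε i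

  -- A minimal circuit (directed cycle of length n in G_{n,2}) traversed starting
  -- at v: c[0] = v, c[k] → c[k+1] (k mod n), all vertices pairwise distinct.
  IsMinCircuitFrom : Subset n → Vec (Subset n) n → Set
  IsMinCircuitFrom v c =
    lookup c (pos 0) ≡ v
    × (∀ k → IsVertex (lookup c k))
    × (∀ k → Edge (lookup c k) (lookup c (succ k)))
    × (∀ i j → lookup c i ≡ lookup c j → i ≡ j)

  -- the set S (simplices of ∇_{n,2} containing v, identified with their unique
  -- minimal circuit, traversed from v)
  InS : ℕ → Subset n → Vec (Subset n) n → Set
  InS r v c =
    IsMinCircuitFrom v c
    × (∀ k → Stable r (lookup c k))
    × (∃ λ k → ¬ Stable (suc r) (lookup c k))

  targets : Vec (Subset n) n → List (Subset n)
  targets c = map (λ k → lookup c (pos (suc k))) (upTo n)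

  -- classify moves, tracking the position p of the left 1:
  -- true = left move (the left 1 leaves p), false = right move
  moves : Fin n → List (Subset n) → List Bool
  moves p [] = []
  moves p (t ∷ ts) with lookup t p
  ... | false = true ∷ moves (succ p) ts
  ... | true  = false ∷ moves p ts

-- counts of left moves (true) in the segments delimited by the right moves (false):
-- entry 0 = before the 1st right move, entry i = between the i-th and (i+1)-st
incHead : List ℕ → List ℕ
incHead []       = []
incHead (x ∷ xs) = suc x ∷ xs

segs : List Bool → List ℕ
segs []           = 0 ∷ []
segs (true ∷ xs)  = incHead (segs xs)
segs (false ∷ xs) = 0 ∷ segs xs

lookupD : List ℕ → ℕ → ℕ
lookupD []       _       = 0
lookupD (x ∷ xs) zero    = x
lookupD (x ∷ xs) (suc i) = lookupD xs i

lam : (n : ℕ) .{{_ : NonZero n}} → (r : ℕ) → Fin n → Vec (Subset n) n → Vec ℕ (n ∸ r ∸ 1)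
lam n r ℓ c = tabulate λ j → lookupD (segs (moves n ℓ (targets n c))) (suc (toℕ j))

InT : (n r : ℕ) → Vec ℕ (n ∸ r ∸ 1) → Set
InT n r μ =
  sum (toList μ) ≡ r
  × (∀ (i : Fin (n ∸ r ∸ 1)) →
       (suc (toℕ i) + 1 + 2 * r ≤ sum (take (suc (toℕ i)) (toList μ)) + n)
       × (sum (take (suc (toℕ i)) (toList μ)) ≤ suc (toℕ i)))

module Submission where

-- Along a circuit starting at v, after L left moves and R right moves the
-- current vertex is  config L R = ε{ℓ+L, ℓ+r+R}.  Its two 1s are at cyclic gap
-- r+R-L, so the vertex is r-stable (with two distinct 1s) exactly when (L,R) lies
-- in the band  L ≤ R ≤ L+n-2r.  Hence a circuit of r-stable vertices is the same
-- thing as a word in left/right moves whose lattice path stays in this band, and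
-- 'moves' reads that word back off the circuit.  The path closes up after n steps
-- exactly when it made r left and n-r right moves; the band then forces the first
-- move to be a right move and no left move to follow the last right move, so the
-- word is  R L^λ₁ R L^λ₂ R … L^λ_{n-r-1} R  (L = left, R = right move), and the
-- band conditions along the way are exactly the prefix-sum bounds of InT.

open import Defs
open import Data.Bool using (Bool; true; false; _∨_; if_then_else_)
open import Data.Bool.Properties using (∨-comm)
open import Data.Nat hiding (_≟_)
open import Data.Nat.Properties hiding (_≟_)
open import Data.Nat.DivMod
open import Data.Nat.Tactic.RingSolver using (solve-∀)
open import Data.Nat.ListAction using (sum)
open import Data.List using (List; []; _∷_; applyUpTo; length; _++_; take)
open import Data.List.Properties using (map-upTo; ∷-injective)
open import Data.Fin using (Fin; toℕ; _≟_) renaming (zero to fzero; suc to fsuc)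
open import Data.Fin.Properties using (toℕ-fromℕ<; toℕ-injective; toℕ<n)
open import Data.Fin.Subset using (Subset; ⁅_⁆; _∪_; ∣_∣)
open import Data.Fin.Subset.Properties using (∪-comm; ∪-identityˡ; ∪-identityʳ; ∣⁅x⁆∣≡1)
open import Data.Vec using (Vec; []; _∷_; lookup; tabulate; toList)
open import Data.Vec.Properties
  using (lookup-zipWith; lookup-replicate; length-toList; lookup∘tabulate; tabulate∘lookup; tabulate-cong)
open import Data.Unit using (⊤; tt)
open import Data.Sum using (_⊎_; inj₁; inj₂)
open import Data.Product using (∃; _×_; _,_; proj₁; proj₂)
open import Data.Empty using (⊥-elim)
open import Relation.Nullary using (¬_; yes; no; does)
open import Relation.Nullary.Decidable using (dec-true; dec-false)
open import Relation.Binary.PropositionalEquality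
open import Function using (_∘_)

-- Positions modulo n.  'pos n X' is the residue of an unreduced position X; all
-- positions of the circuit are handled as unreduced naturals and reduced by pos.
module Positions (n : ℕ) .{{_ : NonZero n}} where

  toℕ-pos : ∀ X → toℕ (pos n X) ≡ X % n
  toℕ-pos X = toℕ-fromℕ< (m%n<n X n)

  %≡⇒pos≡ : ∀ {X Y} → X % n ≡ Y % n → pos n X ≡ pos n Y
  %≡⇒pos≡ {X} {Y} e = toℕ-injective (trans (toℕ-pos X) (trans e (sym (toℕ-pos Y))))

  pos≡⇒%≡ : ∀ {X Y} → pos n X ≡ pos n Y → X % n ≡ Y % n
  pos≡⇒%≡ {X} {Y} e = trans (sym (toℕ-pos X)) (trans (cong toℕ e) (toℕ-pos Y))

  pos-toℕ : (i : Fin n) → pos n (toℕ i) ≡ i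
  pos-toℕ i = toℕ-injective (trans (toℕ-pos (toℕ i)) (m<n⇒m%n≡m (toℕ<n i)))

  pos-+n : ∀ X → pos n (X + n) ≡ pos n X
  pos-+n X = %≡⇒pos≡ ([m+n]%n≡m%n X n)

  [X+d]%n≡[X%n+d]%n : ∀ X d → (X + d) % n ≡ (X % n + d) % n
  [X+d]%n≡[X%n+d]%n X d = begin
      (X + d) % n             ≡⟨ %-distribˡ-+ X d n ⟩
      (X % n + d % n) % n     ≡⟨ cong (λ z → (z + d % n) % n) (sym (m%n%n≡m%n X n)) ⟩
      (X % n % n + d % n) % n ≡⟨ sym (%-distribˡ-+ (X % n) d n) ⟩
      (X % n + d) % n         ∎
    where open ≡-Reasoning

  succ-pos : ∀ X → succ n (pos n X) ≡ pos n (suc X)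
  succ-pos X = %≡⇒pos≡ (begin
      suc (toℕ (pos n X)) % n ≡⟨ cong (λ z → suc z % n) (toℕ-pos X) ⟩
      (1 + X % n) % n         ≡⟨ cong (_% n) (+-comm 1 (X % n)) ⟩
      (X % n + 1) % n         ≡⟨ sym ([X+d]%n≡[X%n+d]%n X 1) ⟩
      (X + 1) % n             ≡⟨ cong (_% n) (+-comm X 1) ⟩
      suc X % n               ∎)
    where open ≡-Reasoning

  wrap-once : ∀ x d → x < n → d ≤ n →
    (x + d < n × (x + d) % n ≡ x + d) ⊎ (n ≤ x + d × (x + d) % n ≡ x + d ∸ n)
  wrap-once x d x<n d≤n with x + d <? n
  ... | yes x+d<n = inj₁ (x+d<n , m<n⇒m%n≡m x+d<n)
  ... | no x+d≮n = inj₂ (n≤x+d , reduce)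
    where
      n≤x+d : n ≤ x + d
      n≤x+d = ≮⇒≥ x+d≮n
      below : x + d ∸ n < n
      below = +-cancelʳ-< n (x + d ∸ n) n
                (subst (_< n + n) (sym (m∸n+n≡m n≤x+d)) (+-mono-<-≤ x<n d≤n))
      reduce : (x + d) % n ≡ x + d ∸ n
      reduce = begin
        (x + d) % n         ≡⟨ cong (_% n) (sym (m∸n+n≡m n≤x+d)) ⟩
        (x + d ∸ n + n) % n ≡⟨ [m+n]%n≡m%n (x + d ∸ n) n ⟩
        (x + d ∸ n) % n     ≡⟨ m<n⇒m%n≡m below ⟩
        x + d ∸ n           ∎
        where open ≡-Reasoning

  same-residue-shift : ∀ X d → d ≤ n → X % n ≡ (X + d) % n → d ≡ 0 ⊎ d ≡ n
  same-residue-shift X d d≤n e with wrap-once (X % n) d (m%n<n X n) d≤n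
  ... | inj₁ (_ , w) = inj₁ (sym (+-cancelˡ-≡ (X % n) 0 d
          (trans (+-identityʳ _) (trans e (trans ([X+d]%n≡[X%n+d]%n X d) w)))))
  ... | inj₂ (n≤ , w) = inj₂ (+-cancelˡ-≡ (X % n) d n (begin
          X % n + d         ≡⟨ sym (m∸n+n≡m n≤) ⟩
          X % n + d ∸ n + n ≡⟨ cong (_+ n) (sym (trans e (trans ([X+d]%n≡[X%n+d]%n X d) w))) ⟩
          X % n + n         ∎))
    where open ≡-Reasoning

  pos-injective : ∀ t A B → A < n → B < n → pos n (t + A) ≡ pos n (t + B) → A ≡ B
  pos-injective t A B A<n B<n e with ≤-total A B
  ... | inj₁ A≤B with m≤n⇒∃[o]m+o≡n A≤B
  ...   | k , refl with same-residue-shift (t + A) k (≤-trans (m≤n+m k A) (<⇒≤ B<n))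
                          (trans (pos≡⇒%≡ e) (cong (_% n) (sym (+-assoc t A k))))
  ...     | inj₁ refl = sym (+-identityʳ A)
  ...     | inj₂ refl = ⊥-elim (<⇒≱ B<n (m≤n+m n A))
  pos-injective t A B A<n B<n e | inj₂ B≤A with m≤n⇒∃[o]m+o≡n B≤A
  ...   | k , refl with same-residue-shift (t + B) k (≤-trans (m≤n+m k B) (<⇒≤ A<n))
                          (trans (sym (pos≡⇒%≡ e)) (cong (_% n) (sym (+-assoc t B k))))
  ...     | inj₁ refl = +-identityʳ B
  ...     | inj₂ refl = ⊥-elim (<⇒≱ A<n (m≤n+m n B))

  cd-shift : ∀ X d → d ≤ n → cd n (pos n X) (pos n (X + d)) ≡ d ⊓ (n ∸ d)
  cd-shift X d d≤n rewrite toℕ-pos X | toℕ-pos (X + d) | [X+d]%n≡[X%n+d]%n X d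
    with wrap-once (X % n) d (m%n<n X n) d≤n
  ... | inj₁ (_ , w) rewrite w | ∣m-m+n∣≡n (X % n) d = refl
  ... | inj₂ (n≤ , w) rewrite w = begin
        ∣ x - y ∣ ⊓ (n ∸ ∣ x - y ∣) ≡⟨ cong (λ z → z ⊓ (n ∸ z)) distance ⟩
        (n ∸ d) ⊓ (n ∸ (n ∸ d))     ≡⟨ cong ((n ∸ d) ⊓_) (m∸[m∸n]≡n d≤n) ⟩
        (n ∸ d) ⊓ d                 ≡⟨ ⊓-comm (n ∸ d) d ⟩
        d ⊓ (n ∸ d)                 ∎
    where
      open ≡-Reasoning
      x y : ℕ
      x = X % n
      y = X % n + d ∸ n
      x≡y+[n∸d] : x ≡ y + (n ∸ d)
      x≡y+[n∸d] = +-cancelʳ-≡ d x (y + (n ∸ d)) (begin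
        x + d           ≡⟨ sym (m∸n+n≡m n≤) ⟩
        y + n           ≡⟨ cong (y +_) (sym (m∸n+n≡m d≤n)) ⟩
        y + (n ∸ d + d) ≡⟨ sym (+-assoc y (n ∸ d) d) ⟩
        y + (n ∸ d) + d ∎)
      distance : ∣ x - y ∣ ≡ n ∸ d
      distance = trans (cong (∣_- y ∣) x≡y+[n∸d])
                   (trans (∣-∣-comm (y + (n ∸ d)) y) (∣m-m+n∣≡n y (n ∸ d)))

  pos-sum : ∀ X Y → (toℕ (pos n X) + toℕ (pos n Y)) % n ≡ (X + Y) % n
  pos-sum X Y rewrite toℕ-pos X | toℕ-pos Y = sym (%-distribˡ-+ X Y n)

  cd-sym : ∀ i j → cd n i j ≡ cd n j i
  cd-sym i j = cong (λ z → z ⊓ (n ∸ z)) (∣-∣-comm (toℕ i) (toℕ j))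

vec-ext : ∀ {A : Set} {m} (u v : Vec A m) → (∀ k → lookup u k ≡ lookup v k) → u ≡ v
vec-ext u v h = trans (sym (tabulate∘lookup u)) (trans (tabulate-cong h) (tabulate∘lookup v))

lookup-⁅⁆ : ∀ {m} (i k : Fin m) → lookup ⁅ i ⁆ k ≡ does (k ≟ i)
lookup-⁅⁆ fzero    fzero    = refl
lookup-⁅⁆ fzero    (fsuc k) = lookup-replicate k false
lookup-⁅⁆ (fsuc i) fzero    = refl
lookup-⁅⁆ (fsuc i) (fsuc k) = lookup-⁅⁆ i k

∣pair∣≡2 : ∀ {m} (a b : Fin m) → a ≢ b → ∣ ⁅ a ⁆ ∪ ⁅ b ⁆ ∣ ≡ 2
∣pair∣≡2 fzero    fzero    a≢b = ⊥-elim (a≢b refl)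
∣pair∣≡2 fzero    (fsuc b) a≢b = cong suc (trans (cong ∣_∣ (∪-identityˡ ⁅ b ⁆)) (∣⁅x⁆∣≡1 b))
∣pair∣≡2 (fsuc a) fzero    a≢b = cong suc (trans (cong ∣_∣ (∪-identityʳ ⁅ a ⁆)) (∣⁅x⁆∣≡1 a))
∣pair∣≡2 (fsuc a) (fsuc b) a≢b = ∣pair∣≡2 a b (λ e → a≢b (cong fsuc e))

module Pairs (n : ℕ) .{{_ : NonZero n}} where

  lookup-pair : ∀ a b k → lookup (ε2 n a b) k ≡ does (k ≟ a) ∨ does (k ≟ b)
  lookup-pair a b k =
    trans (lookup-zipWith _∨_ k ⁅ a ⁆ ⁅ b ⁆) (cong₂ _∨_ (lookup-⁅⁆ a k) (lookup-⁅⁆ b k))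

  pair-first : ∀ a b → lookup (ε2 n a b) a ≡ true
  pair-first a b rewrite lookup-pair a b a | dec-true (a ≟ a) refl = refl

  pair-second : ∀ a b → lookup (ε2 n a b) b ≡ true
  pair-second a b rewrite lookup-pair a b b | dec-true (b ≟ b) refl | ∨-comm (does (b ≟ a)) true = refl

  pair-outside : ∀ a b k → k ≢ a → k ≢ b → lookup (ε2 n a b) k ≡ false
  pair-outside a b k k≢a k≢b rewrite lookup-pair a b k | dec-false (k ≟ a) k≢a | dec-false (k ≟ b) k≢b = refl

  pair-members : ∀ a b k → lookup (ε2 n a b) k ≡ true → k ≡ a ⊎ k ≡ b
  pair-members a b k e rewrite lookup-pair a b k with k ≟ a | k ≟ b
  ... | yes k≡a | _       = inj₁ k≡a
  ... | no _    | yes k≡b = inj₂ k≡b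
  ... | no _    | no _    with () ← e

  pair-comm : ∀ a b → ε2 n a b ≡ ε2 n b a
  pair-comm a b = ∪-comm ⁅ a ⁆ ⁅ b ⁆

  pair-injective : ∀ a b a′ b′ → a ≢ b → ε2 n a b ≡ ε2 n a′ b′ → (a ≡ a′ × b ≡ b′) ⊎ (a ≡ b′ × b ≡ a′)
  pair-injective a b a′ b′ a≢b e
    with pair-members a′ b′ a (subst (λ z → lookup z a ≡ true) e (pair-first a b))
       | pair-members a′ b′ b (subst (λ z → lookup z b ≡ true) e (pair-second a b))
  ... | inj₁ a≡a′ | inj₁ b≡a′ = ⊥-elim (a≢b (trans a≡a′ (sym b≡a′)))
  ... | inj₁ a≡a′ | inj₂ b≡b′ = inj₁ (a≡a′ , b≡b′)
  ... | inj₂ a≡b′ | inj₁ b≡a′ = inj₂ (a≡b′ , b≡a′)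
  ... | inj₂ a≡b′ | inj₂ b≡b′ = ⊥-elim (a≢b (trans a≡b′ (sym b≡b′)))

  pair-sum : ∀ a b a′ b′ → a ≢ b → ε2 n a b ≡ ε2 n a′ b′ → toℕ a + toℕ b ≡ toℕ a′ + toℕ b′
  pair-sum a b a′ b′ a≢b e with pair-injective a b a′ b′ a≢b e
  ... | inj₁ (refl , refl) = refl
  ... | inj₂ (refl , refl) = +-comm (toℕ a) (toℕ b)

  swap-into-gap : ∀ a b → a ≢ b → succ n a ≢ a → succ n a ≢ b →
    swapAt n (ε2 n a b) a ≡ ε2 n (succ n a) b
  swap-into-gap a b a≢b sa≢a sa≢b = vec-ext _ _ λ k → trans (lookup∘tabulate _ k) (entry k)
    where
      entry : ∀ k → (if does (k ≟ a) then lookup (ε2 n a b) (succ n a)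
                     else if does (k ≟ succ n a) then lookup (ε2 n a b) a
                     else lookup (ε2 n a b) k) ≡ lookup (ε2 n (succ n a) b) k
      entry k with k ≟ a
      ... | yes refl = trans (pair-outside a b (succ n a) sa≢a sa≢b)
                         (sym (pair-outside (succ n a) b k (λ e → sa≢a (sym e)) a≢b))
      ... | no k≢a with k ≟ succ n a
      ... | yes refl = trans (pair-first a b) (sym (pair-first (succ n a) b))
      ... | no k≢sa rewrite lookup-pair a b k | lookup-pair (succ n a) b k
                          | dec-false (k ≟ a) k≢a | dec-false (k ≟ succ n a) k≢sa = refl

  edge-cases : ∀ a b t → a ≢ b → Edge n (ε2 n a b) t →
    (t ≡ ε2 n (succ n a) b × succ n a ≢ b) ⊎ (t ≡ ε2 n a (succ n b) × succ n b ≢ a)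
  edge-cases a b t a≢b (i , i∈ , si∉ , t≡) with pair-members a b i i∈
  ... | inj₁ refl = inj₁ (trans t≡ (swap-into-gap a b a≢b (empty a (pair-first a b)) (empty b (pair-second a b))) ,
                           empty b (pair-second a b))
    where
      empty : ∀ k → lookup (ε2 n a b) k ≡ true → succ n a ≢ k
      empty k k∈ refl with () ← trans (sym k∈) si∉
  ... | inj₂ refl = inj₂ (trans t≡ (trans (cong (λ z → swapAt n z i) (pair-comm a i))
                             (trans (swap-into-gap i a (λ e → a≢b (sym e)) (empty i (pair-second a i)) (empty a (pair-first a i)))
                                    (pair-comm (succ n i) a))) ,
                           empty a (pair-first a i))
    where
      empty : ∀ k → lookup (ε2 n a i) k ≡ true → succ n i ≢ k
      empty k k∈ refl with () ← trans (sym k∈) si∉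

lefts : List Bool → ℕ
lefts []           = 0
lefts (true ∷ w)   = suc (lefts w)
lefts (false ∷ w)  = lefts w

rights : List Bool → ℕ
rights []          = 0
rights (true ∷ w)  = rights w
rights (false ∷ w) = suc (rights w)

length≡lefts+rights : ∀ w → length w ≡ lefts w + rights w
length≡lefts+rights []          = refl
length≡lefts+rights (true ∷ w)  = cong suc (length≡lefts+rights w)
length≡lefts+rights (false ∷ w) = trans (cong suc (length≡lefts+rights w)) (sym (+-suc (lefts w) (rights w)))

leftRun : ℕ → List Bool → List Bool
leftRun zero    w = w
leftRun (suc x) w = true ∷ leftRun x w

-- blocks (x₁ ∷ … ∷ x_k) t = L^x₁ R L^x₂ R … L^x_k R L^t:
-- x_i left moves before the i-th right move, then t trailing left moves
blocks : List ℕ → ℕ → List Bool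
blocks []      t = leftRun t []
blocks (x ∷ μ) t = leftRun x (false ∷ blocks μ t)

blocks-surjective : ∀ w → ∃ λ μ → ∃ λ t → w ≡ blocks μ t
blocks-surjective [] = [] , 0 , refl
blocks-surjective (false ∷ w) with blocks-surjective w
... | μ , t , refl = 0 ∷ μ , t , refl
blocks-surjective (true ∷ w) with blocks-surjective w
... | []    , t , refl = [] , suc t , refl
... | x ∷ μ , t , refl = suc x ∷ μ , t , refl

segs-leftRun : ∀ x w → segs (leftRun x (false ∷ w)) ≡ x ∷ segs w
segs-leftRun zero    w = refl
segs-leftRun (suc x) w rewrite segs-leftRun x w = refl

segs-blocks : ∀ μ → segs (blocks μ 0) ≡ μ ++ (0 ∷ [])
segs-blocks []      = refl
segs-blocks (x ∷ μ) = trans (segs-leftRun x (blocks μ 0)) (cong (x ∷_) (segs-blocks μ))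

lefts-leftRun : ∀ x w → lefts (leftRun x w) ≡ x + lefts w
lefts-leftRun zero    w = refl
lefts-leftRun (suc x) w = cong suc (lefts-leftRun x w)

rights-leftRun : ∀ x w → rights (leftRun x w) ≡ rights w
rights-leftRun zero    w = refl
rights-leftRun (suc x) w = rights-leftRun x w

lefts-blocks : ∀ μ t → lefts (blocks μ t) ≡ sum μ + t
lefts-blocks []      t = trans (lefts-leftRun t []) (+-identityʳ t)
lefts-blocks (x ∷ μ) t = trans (lefts-leftRun x _)
  (trans (cong (x +_) (lefts-blocks μ t)) (sym (+-assoc x (sum μ) t)))

rights-blocks : ∀ μ t → rights (blocks μ t) ≡ length μ
rights-blocks []      t = rights-leftRun t []
rights-blocks (x ∷ μ) t = trans (rights-leftRun x _) (cong suc (rights-blocks μ t))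

applyUpTo-cong : ∀ {A : Set} m (f g : ℕ → A) → (∀ k → k < m → f k ≡ g k) → applyUpTo f m ≡ applyUpTo g m
applyUpTo-cong zero    f g h = refl
applyUpTo-cong (suc m) f g h =
  cong₂ _∷_ (h 0 (s≤s z≤n)) (applyUpTo-cong m (f ∘ suc) (g ∘ suc) (λ k k<m → h (suc k) (s≤s k<m)))

applyUpTo-injective : ∀ {A : Set} m (f g : ℕ → A) → applyUpTo f m ≡ applyUpTo g m → ∀ k → k < m → f k ≡ g k
applyUpTo-injective (suc m) f g e zero    _         = proj₁ (∷-injective e)
applyUpTo-injective (suc m) f g e (suc k) (s≤s k<m) =
  applyUpTo-injective m (f ∘ suc) (g ∘ suc) (proj₂ (∷-injective e)) k k<m

tabulate-lookupD : ∀ {m} (ν : Vec ℕ m) ys → tabulate (λ j → lookupD (toList ν ++ ys) (toℕ j)) ≡ ν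
tabulate-lookupD []      ys = refl
tabulate-lookupD (x ∷ ν) ys = cong (x ∷_) (tabulate-lookupD ν ys)

toList-tabulate-lookupD : ∀ m (μ : List ℕ) ys → length μ ≡ m →
  toList (tabulate {n = m} (λ j → lookupD (μ ++ ys) (toℕ j))) ≡ μ
toList-tabulate-lookupD zero    []      ys _ = refl
toList-tabulate-lookupD (suc m) (x ∷ μ) ys e = cong (x ∷_) (toList-tabulate-lookupD m μ ys (suc-injective e))

-- Two counting facts about closed words, with r left moves among N:
-- no left move can follow the last right move once R + 2r ≤ L + N holds at the
-- end (here S + t = r lefts, q = N - r rights) ...
no-trailing-lefts : ∀ S t q r N → S + t ≡ r → r + q ≡ N → q + r + r ≤ S + N → t ≡ 0
no-trailing-lefts S t q r N refl refl le =
  n≤0⇒n≡0 (+-cancelˡ-≤ (q + S + S + t) t 0 (subst₂ _≤_ (shapeˡ S t q) (shapeʳ S t q) le))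
  where
    shapeˡ : ∀ S t q → q + (S + t) + (S + t) ≡ q + S + S + t + t
    shapeˡ = solve-∀
    shapeʳ : ∀ S t q → S + (S + t + q) ≡ q + S + S + t + 0
    shapeʳ = solve-∀

-- ... and the blocks between the first and the last right move number N - r - 1
blocks-count : ∀ r q N → r + suc q ≡ N → q ≡ N ∸ r ∸ 1
blocks-count r q N refl = sym (cong (_∸ 1) (m+n∸m≡n r (suc q)))

-- Configurations.  With r = suc r' and 2r < n, config L R = ε{ℓ+L, ℓ+r+R} is the
-- vertex reached from v = config 0 0 after L left moves and R right moves.
module Configurations (n : ℕ) .{{_ : NonZero n}} (r' : ℕ) (ℓ : Fin n) (2r<n : suc r' + suc r' < n) where
  open Positions n
  open Pairs n

  r : ℕ
  r = suc r'

  0<r : 0 < r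
  0<r = s≤s z≤n

  r<n : r < n
  r<n = ≤-trans (s≤s (m≤m+n r r)) 2r<n

  2<n : 2 < n
  2<n = ≤-trans (s≤s (s≤s (s≤s z≤n))) (≤-trans (+-monoʳ-≤ 1 (+-mono-≤ 0<r 0<r)) 2r<n)

  left : ℕ → ℕ
  left L = toℕ ℓ + L

  right : ℕ → ℕ
  right R = toℕ ℓ + r + R

  config : ℕ → ℕ → Subset n
  config L R = ε2 n (pos n (left L)) (pos n (right R))

  -- the gap r+R-L between the two 1s lies in [r, n-r]
  Band : ℕ → ℕ → Set
  Band L R = L ≤ R × R + r + r ≤ L + n

  band-gap : ∀ L R → Band L R → ∃ λ k → R ≡ L + k × k + r + r ≤ n
  band-gap L R (L≤R , upper) with m≤n⇒∃[o]m+o≡n L≤R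
  ... | k , refl = k , refl , +-cancelˡ-≤ L _ _ (subst₂ _≤_ (shape L k r') refl upper)
    where shape : ∀ L k r' → L + k + suc r' + suc r' ≡ L + (k + suc r' + suc r')
          shape = solve-∀

  right-as-shift : ∀ L k → right (L + k) ≡ left L + (r + k)
  right-as-shift L k = shape (toℕ ℓ) L k r'
    where shape : ∀ t L k r' → t + suc r' + (L + k) ≡ t + L + (suc r' + k)
          shape = solve-∀

  shift-distinct : ∀ Z d → r ≤ d → d + r ≤ n → pos n Z ≢ pos n (Z + d)
  shift-distinct Z d r≤d d+r≤n e with same-residue-shift Z d (≤-trans (m≤m+n d r) d+r≤n) (pos≡⇒%≡ e)
  ... | inj₁ refl = <⇒≱ 0<r r≤d
  ... | inj₂ refl = <⇒≱ 0<r (+-cancelˡ-≤ n r 0 (subst (n + r ≤_) (sym (+-identityʳ n)) d+r≤n))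

  shift-cd : ∀ Z d → r ≤ d → d + r ≤ n → r ≤ cd n (pos n Z) (pos n (Z + d))
  shift-cd Z d r≤d d+r≤n =
    subst (r ≤_) (sym (cd-shift Z d (≤-trans (m≤m+n d r) d+r≤n))) (⊓-glb r≤d r≤n∸d)
    where
      r≤n∸d : r ≤ n ∸ d
      r≤n∸d = subst (_≤ n ∸ d) (m+n∸m≡n d r) (∸-monoˡ-≤ d d+r≤n)

  shift-stable : ∀ Z d → r ≤ d → d + r ≤ n → Stable n r (ε2 n (pos n Z) (pos n (Z + d)))
  shift-stable Z d r≤d d+r≤n i j i≢j i∈ j∈
    with pair-members (pos n Z) (pos n (Z + d)) i i∈ | pair-members (pos n Z) (pos n (Z + d)) j j∈
  ... | inj₁ refl | inj₁ refl = ⊥-elim (i≢j refl)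
  ... | inj₂ refl | inj₂ refl = ⊥-elim (i≢j refl)
  ... | inj₁ refl | inj₂ refl = shift-cd Z d r≤d d+r≤n
  ... | inj₂ refl | inj₁ refl = subst (r ≤_) (cd-sym (pos n Z) (pos n (Z + d))) (shift-cd Z d r≤d d+r≤n)

  stable-shift-bounds : ∀ Z d → d ≤ n → pos n Z ≢ pos n (Z + d) →
    Stable n r (ε2 n (pos n Z) (pos n (Z + d))) → r ≤ d × r ≤ n ∸ d
  stable-shift-bounds Z d d≤n distinct stable = ≤-trans r≤min (m⊓n≤m d (n ∸ d)) , ≤-trans r≤min (m⊓n≤n d (n ∸ d))
    where
      r≤min : r ≤ d ⊓ (n ∸ d)
      r≤min = subst (r ≤_) (cd-shift Z d d≤n)
        (stable (pos n Z) (pos n (Z + d)) distinct (pair-first (pos n Z) (pos n (Z + d))) (pair-second (pos n Z) (pos n (Z + d))))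

  band-distinct : ∀ L R → Band L R → pos n (left L) ≢ pos n (right R)
  band-distinct L R band with band-gap L R band
  ... | k , refl , gap = subst (λ z → pos n (left L) ≢ pos n z) (sym (right-as-shift L k))
          (shift-distinct (left L) (r + k) (m≤m+n r k) (subst₂ _≤_ (shape k r') refl gap))
    where shape : ∀ k r' → k + suc r' + suc r' ≡ suc r' + k + suc r'
          shape = solve-∀

  band-stable : ∀ L R → Band L R → Stable n r (config L R)
  band-stable L R band with band-gap L R band
  ... | k , refl , gap = subst (λ z → Stable n r (ε2 n (pos n (left L)) (pos n z))) (sym (right-as-shift L k))
          (shift-stable (left L) (r + k) (m≤m+n r k) (subst₂ _≤_ (shape k r') refl gap))
    where shape : ∀ k r' → k + suc r' + suc r' ≡ suc r' + k + suc r'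
          shape = solve-∀

  -- since n ≥ 3, a 1 moved one step lands on a different position; succ advances left/right
  succ-moves : ∀ Z → pos n (suc Z) ≢ pos n Z
  succ-moves Z e with same-residue-shift Z 1 (<⇒≤ (≤-trans (s≤s (s≤s z≤n)) 2<n))
                        (trans (sym (pos≡⇒%≡ e)) (cong (_% n) (+-comm 1 Z)))
  ... | inj₁ ()
  ... | inj₂ refl = <⇒≱ 2<n (s≤s z≤n)

  succ-left : ∀ L → succ n (pos n (left L)) ≡ pos n (left (suc L))
  succ-left L = trans (succ-pos (left L)) (cong (pos n) (sym (+-suc (toℕ ℓ) L)))

  succ-right : ∀ R → succ n (pos n (right R)) ≡ pos n (right (suc R))
  succ-right R = trans (succ-pos (right R)) (cong (pos n) (sym (+-suc (toℕ ℓ + r) R)))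

  left-moves : ∀ L → pos n (left (suc L)) ≢ pos n (left L)
  left-moves L e = succ-moves (left L) (trans (cong (pos n) (sym (+-suc (toℕ ℓ) L))) e)

  right-moves : ∀ R → pos n (right (suc R)) ≢ pos n (right R)
  right-moves R e = succ-moves (right R) (trans (cong (pos n) (sym (+-suc (toℕ ℓ + r) R))) e)

  left-edge : ∀ L R → Band L R → Band (suc L) R → Edge n (config L R) (config (suc L) R)
  left-edge L R band band′ = a , pair-first a b , pair-outside a b (succ n a) sa≢a sa≢b ,
      trans (cong (λ z → ε2 n z b) (sym (succ-left L))) (sym (swap-into-gap a b (band-distinct L R band) sa≢a sa≢b))
    where
      a b : Fin n
      a = pos n (left L)
      b = pos n (right R)
      sa≢a : succ n a ≢ a
      sa≢a e = left-moves L (trans (sym (succ-left L)) e)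
      sa≢b : succ n a ≢ b
      sa≢b e = band-distinct (suc L) R band′ (trans (sym (succ-left L)) e)

  right-edge : ∀ L R → Band L R → Band L (suc R) → Edge n (config L R) (config L (suc R))
  right-edge L R band band′ =
      b , pair-second a b , subst (λ z → lookup z (succ n b) ≡ false) (pair-comm b a) (pair-outside b a (succ n b) sb≢b sb≢a) ,
      (begin
        config L (suc R)                 ≡⟨ pair-comm a (pos n (right (suc R))) ⟩
        ε2 n (pos n (right (suc R))) a   ≡⟨ cong (λ z → ε2 n z a) (sym (succ-right R)) ⟩
        ε2 n (succ n b) a                ≡⟨ sym (swap-into-gap b a (λ e → band-distinct L R band (sym e)) sb≢b sb≢a) ⟩
        swapAt n (ε2 n b a) b            ≡⟨ cong (λ z → swapAt n z b) (pair-comm b a) ⟩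
        swapAt n (config L R) b          ∎)
    where
      open ≡-Reasoning
      a b : Fin n
      a = pos n (left L)
      b = pos n (right R)
      sb≢b : succ n b ≢ b
      sb≢b e = right-moves R (trans (sym (succ-right R)) e)
      sb≢a : succ n b ≢ a
      sb≢a e = band-distinct L (suc R) band′ (sym (trans (sym (succ-right R)) e))

  left-step-in-band : ∀ L R → Band L R → pos n (left (suc L)) ≢ pos n (right R) →
    Stable n r (config (suc L) R) → Band (suc L) R
  left-step-in-band L R band distinct stable with band-gap L R band
  ... | k , refl , gap = L<L+k , ≤-trans (proj₂ band) (n≤1+n (L + n))
    where
      shifted : right (L + k) ≡ left (suc L) + (r' + k)
      shifted = shape (toℕ ℓ) L k r'
        where shape : ∀ t L k r' → t + suc r' + (L + k) ≡ t + suc L + (r' + k)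
              shape = solve-∀
      r'+k≤n : r' + k ≤ n
      r'+k≤n = subst₂ _≤_ (+-comm k r') refl
                 (≤-trans (+-monoʳ-≤ k (n≤1+n r')) (≤-trans (m≤m+n (k + r) r) gap))
      bounds : r ≤ r' + k × r ≤ n ∸ (r' + k)
      bounds = stable-shift-bounds (left (suc L)) (r' + k) r'+k≤n
                 (λ e → distinct (trans e (sym (cong (pos n) shifted))))
                 (subst (λ z → Stable n r (ε2 n (pos n (left (suc L))) (pos n z))) shifted stable)
      L<L+k : suc L ≤ L + k
      L<L+k = subst₂ _≤_ (+-comm L 1) refl
                (+-monoʳ-≤ L (+-cancelˡ-≤ r' 1 k (subst₂ _≤_ (+-comm 1 r') refl (proj₁ bounds))))

  right-step-in-band : ∀ L R → Band L R → pos n (left L) ≢ pos n (right (suc R)) →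
    Stable n r (config L (suc R)) → Band L (suc R)
  right-step-in-band L R band distinct stable with band-gap L R band
  ... | k , refl , gap = ≤-trans (proj₁ band) (n≤1+n _) , upper
    where
      shifted : right (suc (L + k)) ≡ left L + suc (r + k)
      shifted = shape (toℕ ℓ) L k r'
        where shape : ∀ t L k r' → t + suc r' + suc (L + k) ≡ t + L + suc (suc r' + k)
              shape = solve-∀
      d≤n : suc (r + k) ≤ n
      d≤n = ≤-trans (subst₂ _≤_ (shape k r') refl (+-monoʳ-≤ (k + r) 0<r)) gap
        where shape : ∀ k r' → k + suc r' + 1 ≡ suc (suc r' + k)
              shape = solve-∀
      bounds : r ≤ suc (r + k) × r ≤ n ∸ suc (r + k)
      bounds = stable-shift-bounds (left L) (suc (r + k)) d≤n
                 (λ e → distinct (trans e (sym (cong (pos n) shifted))))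
                 (subst (λ z → Stable n r (ε2 n (pos n (left L)) (pos n z))) shifted stable)
      upper : suc (L + k) + r + r ≤ L + n
      upper = subst₂ _≤_ (shape L k r') refl (+-monoʳ-≤ L (m≤o∸n⇒m+n≤o r d≤n (proj₂ bounds)))
        where shape : ∀ L k r' → L + (suc r' + suc (suc r' + k)) ≡ suc (L + k) + suc r' + suc r'
              shape = solve-∀

  BandWord : ℕ → ℕ → List Bool → Set
  BandWord L R []          = ⊤
  BandWord L R (true ∷ w)  = Band (suc L) R × BandWord (suc L) R w
  BandWord L R (false ∷ w) = Band L (suc R) × BandWord L (suc R) w

  stateAfter : ℕ → ℕ → List Bool → ℕ → ℕ × ℕ
  stateAfter L R w           zero    = L , R
  stateAfter L R []          (suc k) = L , R
  stateAfter L R (true ∷ w)  (suc k) = stateAfter (suc L) R w k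
  stateAfter L R (false ∷ w) (suc k) = stateAfter L (suc R) w k

  configAt : ℕ × ℕ → Subset n
  configAt (L , R) = config L R

  InBand : ℕ × ℕ → Set
  InBand (L , R) = Band L R

  configs : ℕ → ℕ → List Bool → List (Subset n)
  configs L R w = applyUpTo (λ k → configAt (stateAfter L R w (suc k))) (length w)

  moves-configs : ∀ L R w → Band L R → BandWord L R w → moves n (pos n (left L)) (configs L R w) ≡ w
  moves-configs L R [] band bw = refl
  moves-configs L R (true ∷ w) band (band′ , bw)
    rewrite pair-outside (pos n (left (suc L))) (pos n (right R)) (pos n (left L))
              (λ e → left-moves L (sym e)) (band-distinct L R band)
          | succ-left L = cong (true ∷_) (moves-configs (suc L) R w band′ bw)
  moves-configs L R (false ∷ w) band (band′ , bw)
    rewrite pair-first (pos n (left L)) (pos n (right (suc R))) = cong (false ∷_) (moves-configs L (suc R) w band′ bw)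

  first-move : ∀ L R t → Band L R → Edge n (config L R) t → Stable n r t →
    (t ≡ config (suc L) R × Band (suc L) R) ⊎ (t ≡ config L (suc R) × Band L (suc R))
  first-move L R t band edge stable
    with edge-cases (pos n (left L)) (pos n (right R)) t (band-distinct L R band) edge
  ... | inj₁ (t≡ , distinct) =
    inj₁ (t≡′ , left-step-in-band L R band (distinct ∘ trans (succ-left L)) (subst (Stable n r) t≡′ stable))
    where
      t≡′ : t ≡ config (suc L) R
      t≡′ = trans t≡ (cong (λ z → ε2 n z (pos n (right R))) (succ-left L))
  ... | inj₂ (t≡ , distinct) =
    inj₂ (t≡′ , right-step-in-band L R band (λ e → distinct (trans (succ-right R) (sym e))) (subst (Stable n r) t≡′ stable))
    where
      t≡′ : t ≡ config L (suc R)
      t≡′ = trans t≡ (cong (ε2 n (pos n (left L))) (succ-right R))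

  walk-to-word : ∀ m (g : ℕ → Subset n) L R → Band L R → Edge n (config L R) (g 0) →
    (∀ k → Edge n (g k) (g (suc k))) → (∀ k → Stable n r (g k)) →
    ∃ λ w → applyUpTo g m ≡ configs L R w × BandWord L R w × length w ≡ m
  walk-to-word zero g L R band e₀ edges stable = [] , refl , tt , refl
  walk-to-word (suc m) g L R band e₀ edges stable with first-move L R (g 0) band e₀ (stable 0)
  ... | inj₁ (g₀≡ , band′)
    with walk-to-word m (g ∘ suc) (suc L) R band′ (subst (λ z → Edge n z (g 1)) g₀≡ (edges 0)) (edges ∘ suc) (stable ∘ suc)
  ... | w , gs≡ , bw , len = true ∷ w , cong₂ _∷_ g₀≡ gs≡ , (band′ , bw) , cong suc len
  walk-to-word (suc m) g L R band e₀ edges stable | inj₂ (g₀≡ , band′)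
    with walk-to-word m (g ∘ suc) L (suc R) band′ (subst (λ z → Edge n z (g 1)) g₀≡ (edges 0)) (edges ∘ suc) (stable ∘ suc)
  ... | w , gs≡ , bw , len = false ∷ w , cong₂ _∷_ g₀≡ gs≡ , (band′ , bw) , cong suc len

  state-in-band : ∀ L R w k → Band L R → BandWord L R w → InBand (stateAfter L R w k)
  state-in-band L R w           zero    band bw          = band
  state-in-band L R []          (suc k) band bw          = band
  state-in-band L R (true ∷ w)  (suc k) band (band′ , bw) = state-in-band (suc L) R w k band′ bw
  state-in-band L R (false ∷ w) (suc k) band (band′ , bw) = state-in-band L (suc R) w k band′ bw

  state-at-end : ∀ L R w → stateAfter L R w (length w) ≡ (L + lefts w , R + rights w)
  state-at-end L R [] = cong₂ _,_ (sym (+-identityʳ L)) (sym (+-identityʳ R))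
  state-at-end L R (true ∷ w) =
    trans (state-at-end (suc L) R w) (cong (_, R + rights w) (sym (+-suc L (lefts w))))
  state-at-end L R (false ∷ w) =
    trans (state-at-end L (suc R) w) (cong (L + lefts w ,_) (sym (+-suc R (rights w))))

  state-total : ∀ L R w k → k ≤ length w →
    proj₁ (stateAfter L R w k) + proj₂ (stateAfter L R w k) ≡ L + R + k
  state-total L R w zero _ = sym (+-identityʳ _)
  state-total L R (true ∷ w) (suc k) (s≤s k≤) = trans (state-total (suc L) R w k k≤) (shape L R k)
    where shape : ∀ L R k → suc L + R + k ≡ L + R + suc k
          shape = solve-∀
  state-total L R (false ∷ w) (suc k) (s≤s k≤) = trans (state-total L (suc R) w k k≤) (shape L R k)
    where shape : ∀ L R k → L + suc R + k ≡ L + R + suc k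
          shape = solve-∀

  state-edge : ∀ L R w k → Band L R → BandWord L R w → suc k ≤ length w →
    Edge n (configAt (stateAfter L R w k)) (configAt (stateAfter L R w (suc k)))
  state-edge L R (true ∷ w)  zero    band (band′ , bw) _ = left-edge L R band band′
  state-edge L R (false ∷ w) zero    band (band′ , bw) _ = right-edge L R band band′
  state-edge L R (true ∷ w)  (suc k) band (band′ , bw) (s≤s k<) = state-edge (suc L) R w k band′ bw k<
  state-edge L R (false ∷ w) (suc k) band (band′ , bw) (s≤s k<) = state-edge L (suc R) w k band′ bw k<

  -- along a run of left moves only L grows: the run stays in the band iff its
  -- endpoint does (R + 2r ≤ L + n only improves, L ≤ R is checked at the end)
  leftRun-in-band : ∀ x L R w → Band L R → BandWord L R (leftRun x w) →
    Band (L + x) R × BandWord (L + x) R w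
  leftRun-in-band zero    L R w band bw = subst (λ z → Band z R × BandWord z R w) (sym (+-identityʳ L)) (band , bw)
  leftRun-in-band (suc x) L R w band (band′ , bw) =
    subst (λ z → Band z R × BandWord z R w) (sym (+-suc L x)) (leftRun-in-band x (suc L) R w band′ bw)

  in-band-leftRun : ∀ x L R w → Band L R → Band (L + x) R → BandWord (L + x) R w → BandWord L R (leftRun x w)
  in-band-leftRun zero    L R w band band-end bw = subst (λ z → BandWord z R w) (+-identityʳ L) bw
  in-band-leftRun (suc x) L R w band band-end bw =
    band′ , in-band-leftRun x (suc L) R w band′ (subst (λ z → Band z R) (+-suc L x) band-end)
                                          (subst (λ z → BandWord z R w) (+-suc L x) bw)
    where
      band′ : Band (suc L) R
      band′ = ≤-trans (subst₂ _≤_ (+-comm L 1) refl (+-monoʳ-≤ L (s≤s {0} {x} z≤n))) (proj₁ band-end) ,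
              ≤-trans (proj₂ band) (n≤1+n _)

  PrefixBound : ℕ → ℕ → Set
  PrefixBound i S = i + 1 + 2 * r ≤ S + n × S ≤ i

  PrefixBounds : ℕ → ℕ → List ℕ → Set
  PrefixBounds i s []      = ⊤
  PrefixBounds i s (x ∷ μ) = PrefixBound (suc i) (s + x) × PrefixBounds (suc i) (s + x) μ

  -- the upper band constraint after the (i+2)-nd right move is the lower prefix bound
  bound-shape : ∀ i → suc i + 1 + 2 * r ≡ suc (suc i) + r + r
  bound-shape i = shape i r'
    where shape : ∀ i r' → suc i + 1 + 2 * suc r' ≡ suc (suc i) + suc r' + suc r'
          shape = solve-∀

  band-to-bounds : ∀ μ t i s → Band s (suc i) → BandWord s (suc i) (blocks μ t) →
    PrefixBounds i s μ × Band (s + sum μ) (suc i + length μ)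
  band-to-bounds [] t i s band bw = tt , subst₂ Band (sym (+-identityʳ s)) (sym (+-identityʳ (suc i))) band
  band-to-bounds (x ∷ μ) t i s band bw with leftRun-in-band x s (suc i) (false ∷ blocks μ t) band bw
  ... | band-x , (band-xR , bw′) with band-to-bounds μ t (suc i) (s + x) band-xR bw′
  ... | bounds , band-end =
    ((subst₂ _≤_ (sym (bound-shape i)) refl (proj₂ band-xR) , proj₁ band-x) , bounds) ,
    subst₂ Band (+-assoc s x (sum μ)) (sym (+-suc (suc i) (length μ))) band-end

  bounds-to-band : ∀ μ i s → Band s (suc i) → PrefixBounds i s μ → BandWord s (suc i) (blocks μ 0)
  bounds-to-band [] i s band bounds = tt
  bounds-to-band (x ∷ μ) i s band (bound , bounds) =
    in-band-leftRun x s (suc i) (false ∷ blocks μ 0) band band-x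
      (band-xR , bounds-to-band μ (suc i) (s + x) band-xR bounds)
    where
      band-x : Band (s + x) (suc i)
      band-x = proj₂ bound , ≤-trans (proj₂ band) (+-monoˡ-≤ n (m≤m+n s x))
      band-xR : Band (s + x) (suc (suc i))
      band-xR = ≤-trans (proj₂ bound) (n≤1+n _) , subst₂ _≤_ (bound-shape i) refl (proj₁ bound)

  vector-bounds : ∀ {m} (ν : Vec ℕ m) i s →
    (∀ (j : Fin m) → PrefixBound (i + suc (toℕ j)) (s + sum (take (suc (toℕ j)) (toList ν)))) →
    PrefixBounds i s (toList ν)
  vector-bounds [] i s h = tt
  vector-bounds (x ∷ ν) i s h =
    subst₂ PrefixBound (+-comm i 1) (cong (s +_) (+-identityʳ x)) (h fzero) ,
    vector-bounds ν (suc i) (s + x)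
      (λ j → subst₂ PrefixBound (+-suc i (suc (toℕ j))) (sym (+-assoc s x _)) (h (fsuc j)))

  bounds-vector : ∀ {m} (ν : Vec ℕ m) i s → PrefixBounds i s (toList ν) →
    (∀ (j : Fin m) → PrefixBound (i + suc (toℕ j)) (s + sum (take (suc (toℕ j)) (toList ν))))
  bounds-vector (x ∷ ν) i s (bound , bounds) fzero =
    subst₂ PrefixBound (+-comm 1 i) (cong (s +_) (sym (+-identityʳ x))) bound
  bounds-vector (x ∷ ν) i s (bound , bounds) (fsuc j) =
    subst₂ PrefixBound (sym (+-suc i (suc (toℕ j)))) (+-assoc s x _) (bounds-vector ν (suc i) (s + x) bounds j)

  -- the positions of config L R add up to 2ℓ + r + (L + R), so a band
  -- configuration determines L + R modulo n
  config-injective : ∀ L R L′ R′ → Band L R → L + R < n → L′ + R′ < n →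
    config L R ≡ config L′ R′ → L + R ≡ L′ + R′
  config-injective L R L′ R′ band L+R<n L′+R′<n e =
    pos-injective c (L + R) (L′ + R′) L+R<n L′+R′<n (%≡⇒pos≡ (begin
      (c + (L + R)) % n ≡⟨ cong (_% n) (sym (positions L R)) ⟩
      (left L + right R) % n ≡⟨ sym (pos-sum (left L) (right R)) ⟩
      (toℕ (pos n (left L)) + toℕ (pos n (right R))) % n
        ≡⟨ cong (_% n) (pair-sum _ _ _ _ (band-distinct L R band) e) ⟩
      (toℕ (pos n (left L′)) + toℕ (pos n (right R′))) % n ≡⟨ pos-sum (left L′) (right R′) ⟩
      (left L′ + right R′) % n ≡⟨ cong (_% n) (positions L′ R′) ⟩
      (c + (L′ + R′)) % n ∎))
    where
      open ≡-Reasoning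
      c : ℕ
      c = toℕ ℓ + toℕ ℓ + r
      positions : ∀ L R → left L + right R ≡ c + (L + R)
      positions L R = shape (toℕ ℓ) L R r
        where shape : ∀ t L R r → t + L + (t + r + R) ≡ t + t + r + (L + R)
              shape = solve-∀

  closing-left-below : ∀ L R → Band L R → L + R ≡ n → L < n
  closing-left-below L zero    (L≤0 , _) L+0≡n =
    ⊥-elim (<⇒≱ r<n (≤-trans (subst (_≤ 0) (trans (sym (+-identityʳ L)) L+0≡n) L≤0) z≤n))
  closing-left-below L (suc R) band L+R≡n = subst (L <_) L+R≡n (m<m+n L (s≤s z≤n))

  closing-needs-r-lefts : ∀ L R → Band L R → L + R ≡ n → config L R ≡ config 0 0 → L ≡ r
  closing-needs-r-lefts L R band L+R≡n e with pair-injective _ _ _ _ (band-distinct L R band) e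
  ... | inj₁ (same-left , _) = ⊥-elim (<⇒≱ n<n+r+r (subst₂ (λ x y → y + r + r ≤ x + n) L≡0 R≡n (proj₂ band)))
    where
      L≡0 : L ≡ 0
      L≡0 = pos-injective (toℕ ℓ) L 0 (closing-left-below L R band L+R≡n) (≤-trans (s≤s z≤n) r<n) same-left
      R≡n : R ≡ n
      R≡n = trans (sym (cong (_+ R) L≡0)) L+R≡n
      n<n+r+r : n < n + r + r
      n<n+r+r = ≤-trans (m<m+n n 0<r) (m≤m+n (n + r) r)
  ... | inj₂ (left-on-right , _) = pos-injective (toℕ ℓ) L r (closing-left-below L R band L+R≡n) r<n
                                     (trans left-on-right (cong (pos n) (+-identityʳ _)))

  closes-after-r-lefts : ∀ L R → L ≡ r → L + R ≡ n → config L R ≡ config 0 0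
  closes-after-r-lefts L R refl r+R≡n = trans (cong₂ (ε2 n) (sym right-0) right-R) (pair-comm _ _)
    where
      right-0 : pos n (right 0) ≡ pos n (left r)
      right-0 = cong (pos n) (+-identityʳ _)
      right-R : pos n (right R) ≡ pos n (left 0)
      right-R = trans (cong (pos n) (trans (+-assoc (toℕ ℓ) r R) (cong (toℕ ℓ +_) r+R≡n)))
                  (trans (pos-+n (toℕ ℓ)) (cong (pos n) (sym (+-identityʳ _))))

  start-not-more-stable : ¬ Stable n (suc r) (config 0 0)
  start-not-more-stable stable = <⇒≱ (s≤s ≤-refl)
    (≤-trans (≤-trans more (≤-reflexive (cd-shift (left 0) r (<⇒≤ r<n)))) (m⊓n≤m r (n ∸ r)))
    where
      right-0 : right 0 ≡ left 0 + r
      right-0 = shape (toℕ ℓ) r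
        where shape : ∀ t r → t + r + 0 ≡ t + 0 + r
              shape = solve-∀
      more : suc r ≤ cd n (pos n (left 0)) (pos n (left 0 + r))
      more = subst (λ z → suc r ≤ cd n (pos n (left 0)) (pos n z)) right-0
        (stable (pos n (left 0)) (pos n (right 0)) (band-distinct 0 0 (z≤n , <⇒≤ 2r<n))
          (pair-first (pos n (left 0)) (pos n (right 0))) (pair-second (pos n (left 0)) (pos n (right 0))))

module Circuits (m r' : ℕ) (ℓ : Fin (suc m)) (2r<n : suc r' + suc r' < suc m) where

  n : ℕ
  n = suc m

  open Positions n
  open Pairs n
  open Configurations n r' ℓ 2r<n

  v : Subset n
  v = ε2 n ℓ (pos n (toℕ ℓ + r))

  left-0 : pos n (left 0) ≡ ℓ
  left-0 = trans (cong (pos n) (+-identityʳ (toℕ ℓ))) (pos-toℕ ℓ)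

  v≡config-0-0 : v ≡ config 0 0
  v≡config-0-0 = cong₂ (ε2 n) (sym left-0) (cong (pos n) (sym (+-identityʳ (toℕ ℓ + r))))

  band-0-0 : Band 0 0
  band-0-0 = z≤n , <⇒≤ 2r<n

  band-0-1 : Band 0 1
  band-0-1 = z≤n , 2r<n

  after : Vec (Subset n) n → ℕ → Subset n
  after c k = lookup c (pos n (suc k))

  targets≡after : ∀ c → targets n c ≡ applyUpTo (after c) n
  targets≡after c = map-upTo (after c) n

  first-edge : ∀ c → lookup c (pos n 0) ≡ v → (∀ k → Edge n (lookup c k) (lookup c (succ n k))) →
    Edge n (config 0 0) (after c 0)
  first-edge c c₀ edges = subst₂ (Edge n) (trans c₀ v≡config-0-0) (cong (lookup c) (succ-pos 0)) (edges (pos n 0))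

  next-edge : ∀ c → (∀ k → Edge n (lookup c k) (lookup c (succ n k))) → ∀ k → Edge n (after c k) (after c (suc k))
  next-edge c edges k = subst (λ z → Edge n (after c k) (lookup c z)) (succ-pos (suc k)) (edges (pos n (suc k)))

  closed-word : ∀ w → BandWord 0 0 w → length w ≡ n → configAt (stateAfter 0 0 w n) ≡ config 0 0 →
    lefts w ≡ r × lefts w + rights w ≡ n
  closed-word w bw len closes =
    closing-needs-r-lefts (lefts w) (rights w) band-end total (subst (λ p → configAt p ≡ config 0 0) end closes) ,
    total
    where
      end : stateAfter 0 0 w n ≡ (lefts w , rights w)
      end = subst (λ k → stateAfter 0 0 w k ≡ (lefts w , rights w)) len (state-at-end 0 0 w)
      total : lefts w + rights w ≡ n
      total = trans (cong (λ p → proj₁ p + proj₂ p) (sym end)) (state-total 0 0 w n (≤-reflexive (sym len)))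
      band-end : Band (lefts w) (rights w)
      band-end = subst InBand end (state-in-band 0 0 w n band-0-0 bw)

  circuit-word : ∀ c → InS n r v c →
    ∃ λ w → targets n c ≡ configs 0 0 w × BandWord 0 0 w × lefts w ≡ r × lefts w + rights w ≡ n
  circuit-word c ((c₀ , _ , edges , _) , stable , _)
    with walk-to-word n (after c) 0 0 band-0-0 (first-edge c c₀ edges) (next-edge c edges) (stable ∘ pos n ∘ suc)
  ... | w , after≡ , bw , len = w , trans (targets≡after c) after≡ , bw , closed-word w bw len closes
    where
      visited : ℕ → Subset n
      visited k = configAt (stateAfter 0 0 w (suc k))
      closes : configAt (stateAfter 0 0 w n) ≡ config 0 0
      closes = trans (sym (applyUpTo-injective n (after c) visited (trans after≡ (cong (applyUpTo visited) len)) m ≤-refl))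
                 (trans (cong (lookup c) (pos-+n 0)) (trans c₀ v≡config-0-0))

  closed-word-blocks : ∀ w → BandWord 0 0 w → lefts w ≡ r → lefts w + rights w ≡ n →
    ∃ λ μ → w ≡ false ∷ blocks μ 0 × PrefixBounds 0 0 μ × sum μ ≡ r × length μ ≡ n ∸ r ∸ 1
  closed-word-blocks (true ∷ w) ((() , _) , _) _ _
  closed-word-blocks (false ∷ w) (band-0-1 , bw) lefts≡r total with blocks-surjective w
  ... | μ , t , refl with band-to-bounds μ t 0 0 band-0-1 bw
  ... | bounds , band-end = μ , cong (λ z → false ∷ blocks μ z) t≡0 , bounds , sum≡r ,
                            blocks-count r (length μ) n r+rights≡n
    where
      sum+t≡r : sum μ + t ≡ r
      sum+t≡r = trans (sym (lefts-blocks μ t)) lefts≡r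
      r+rights≡n : r + suc (length μ) ≡ n
      r+rights≡n = trans (cong₂ _+_ (sym lefts≡r) (cong suc (sym (rights-blocks μ t)))) total
      t≡0 : t ≡ 0
      t≡0 = no-trailing-lefts (sum μ) t (suc (length μ)) r n sum+t≡r r+rights≡n (proj₂ band-end)
      sum≡r : sum μ ≡ r
      sum≡r = trans (sym (+-identityʳ (sum μ))) (trans (cong (sum μ +_) (sym t≡0)) sum+t≡r)

  moves-targets : ∀ c w → targets n c ≡ configs 0 0 w → BandWord 0 0 w → moves n ℓ (targets n c) ≡ w
  moves-targets c w targets≡ bw = trans (cong (moves n ℓ) targets≡)
    (subst (λ p → moves n p (configs 0 0 w) ≡ w) left-0 (moves-configs 0 0 w band-0-0 bw))

  lam-blocks : ∀ c μ → targets n c ≡ configs 0 0 (false ∷ blocks μ 0) → BandWord 0 0 (false ∷ blocks μ 0) →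
    length μ ≡ n ∸ r ∸ 1 → toList (lam n r ℓ c) ≡ μ
  lam-blocks c μ targets≡ bw len rewrite moves-targets c (false ∷ blocks μ 0) targets≡ bw | segs-blocks μ =
    toList-tabulate-lookupD (n ∸ r ∸ 1) μ (0 ∷ []) len

  circuit-sequence : ∀ c → InS n r v c →
    targets n c ≡ configs 0 0 (false ∷ blocks (toList (lam n r ℓ c)) 0) × InT n r (lam n r ℓ c)
  circuit-sequence c c∈S =
    let w , targets≡ , bw , lefts≡r , total = circuit-word c c∈S
        μ , w≡ , bounds , sum≡r , len = closed-word-blocks w bw lefts≡r total
        targets≡blocks : targets n c ≡ configs 0 0 (false ∷ blocks μ 0)
        targets≡blocks = trans targets≡ (cong (configs 0 0) w≡)
        lam≡μ : toList (lam n r ℓ c) ≡ μ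
        lam≡μ = lam-blocks c μ targets≡blocks (subst (BandWord 0 0) w≡ bw) len
    in subst (λ z → targets n c ≡ configs 0 0 (false ∷ blocks z 0)) (sym lam≡μ) targets≡blocks ,
       trans (cong sum lam≡μ) sum≡r ,
       bounds-vector (lam n r ℓ c) 0 0 (subst (PrefixBounds 0 0) (sym lam≡μ) bounds)

  targets-injective : ∀ c c′ → targets n c ≡ targets n c′ → c ≡ c′
  targets-injective c c′ e = vec-ext c c′ same
    where
      after-same : ∀ k → k < n → after c k ≡ after c′ k
      after-same = applyUpTo-injective n (after c) (after c′) (trans (sym (targets≡after c)) (trans e (targets≡after c′)))
      same : ∀ k → lookup c k ≡ lookup c′ k
      same fzero = subst (λ z → lookup c z ≡ lookup c′ z) (pos-+n 0) (after-same m ≤-refl)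
      same (fsuc i) = subst (λ z → lookup c z ≡ lookup c′ z) (pos-toℕ (fsuc i)) (after-same (toℕ i) (≤-trans (toℕ<n i) (n≤1+n m)))

  lam-in-T : ∀ c → InS n r v c → InT n r (lam n r ℓ c)
  lam-in-T c c∈S = proj₂ (circuit-sequence c c∈S)

  lam-injective : ∀ c c′ → InS n r v c → InS n r v c′ → lam n r ℓ c ≡ lam n r ℓ c′ → c ≡ c′
  lam-injective c c′ c∈S c′∈S same-λ = targets-injective c c′ (begin
    targets n c                                     ≡⟨ proj₁ (circuit-sequence c c∈S) ⟩
    configs 0 0 (false ∷ blocks (toList (lam n r ℓ c)) 0)  ≡⟨ cong (λ z → configs 0 0 (false ∷ blocks (toList z) 0)) same-λ ⟩
    configs 0 0 (false ∷ blocks (toList (lam n r ℓ c′)) 0) ≡⟨ sym (proj₁ (circuit-sequence c′ c′∈S)) ⟩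
    targets n c′                                    ∎)
    where open ≡-Reasoning

  module FromSequence (μ : Vec ℕ (n ∸ r ∸ 1)) (μ∈T : InT n r μ) where

    w : List Bool
    w = false ∷ blocks (toList μ) 0

    bw : BandWord 0 0 w
    bw = band-0-1 , bounds-to-band (toList μ) 0 0 band-0-1 (vector-bounds μ 0 0 (proj₂ μ∈T))

    lefts≡r : lefts w ≡ r
    lefts≡r = trans (lefts-blocks (toList μ) 0) (trans (+-identityʳ _) (proj₁ μ∈T))

    total : lefts w + rights w ≡ n
    total = begin
      lefts w + rights w           ≡⟨ cong₂ _+_ lefts≡r (cong suc (trans (rights-blocks (toList μ) 0) (length-toList μ))) ⟩
      r + suc (n ∸ r ∸ 1)          ≡⟨ cong (r +_) (trans (+-comm 1 _) (m∸n+n≡m (m<n⇒0<n∸m r<n))) ⟩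
      r + (n ∸ r)                  ≡⟨ m+[n∸m]≡n (<⇒≤ r<n) ⟩
      n                            ∎
      where open ≡-Reasoning

    len : length w ≡ n
    len = trans (length≡lefts+rights w) total

    state : ℕ → ℕ × ℕ
    state = stateAfter 0 0 w

    c : Vec (Subset n) n
    c = tabulate (λ i → configAt (state (toℕ i)))

    lookup-c : ∀ i → lookup c i ≡ configAt (state (toℕ i))
    lookup-c i = lookup∘tabulate (λ i → configAt (state (toℕ i))) i

    state-total′ : ∀ K → K ≤ n → proj₁ (state K) + proj₂ (state K) ≡ K
    state-total′ K K≤n = state-total 0 0 w K (≤-trans K≤n (≤-reflexive (sym len)))

    -- after n moves the word is back at v, so indices may be taken mod n
    lookup-c-pos : ∀ K → K ≤ n → lookup c (pos n K) ≡ configAt (state K)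
    lookup-c-pos K K≤n with m≤n⇒m<n∨m≡n K≤n
    ... | inj₁ K<n = trans (lookup-c (pos n K)) (cong (configAt ∘ state) (trans (toℕ-pos K) (m<n⇒m%n≡m K<n)))
    ... | inj₂ refl = trans (cong (lookup c) (pos-+n 0)) (sym closes)
      where
        end : state n ≡ (lefts w , rights w)
        end = subst (λ z → state z ≡ (lefts w , rights w)) len (state-at-end 0 0 w)
        closes : configAt (state n) ≡ config 0 0
        closes = trans (cong configAt end) (closes-after-r-lefts (lefts w) (rights w) lefts≡r total)

    -- the k-th vertex has L + R = k, which config determines: the vertices are distinct
    in-band : ∀ K → InBand (state K)
    in-band K = state-in-band 0 0 w K band-0-0 bw

    distinct-vertices : ∀ i j → lookup c i ≡ lookup c j → i ≡ j
    distinct-vertices i j e = toℕ-injective (begin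
      toℕ i                                 ≡⟨ sym (state-total′ (toℕ i) (<⇒≤ (toℕ<n i))) ⟩
      proj₁ (state (toℕ i)) + proj₂ (state (toℕ i))
        ≡⟨ config-injective _ _ _ _ (in-band (toℕ i)) (below i) (below j) (trans (sym (lookup-c i)) (trans e (lookup-c j))) ⟩
      proj₁ (state (toℕ j)) + proj₂ (state (toℕ j)) ≡⟨ state-total′ (toℕ j) (<⇒≤ (toℕ<n j)) ⟩
      toℕ j                                 ∎)
      where
        open ≡-Reasoning
        below : ∀ i → proj₁ (state (toℕ i)) + proj₂ (state (toℕ i)) < n
        below i = subst (_< n) (sym (state-total′ (toℕ i) (<⇒≤ (toℕ<n i)))) (toℕ<n i)

    c∈S : InS n r v c
    c∈S = (starts , vertices , edges , distinct-vertices) , stable , (pos n 0 , not-more-stable)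
      where
        starts : lookup c (pos n 0) ≡ v
        starts = trans (lookup-c-pos 0 z≤n) (sym v≡config-0-0)
        vertices : ∀ k → IsVertex n (lookup c k)
        vertices k rewrite lookup-c k = ∣pair∣≡2 _ _ (band-distinct _ _ (in-band (toℕ k)))
        edges : ∀ k → Edge n (lookup c k) (lookup c (succ n k))
        edges k = subst₂ (Edge n) (sym (lookup-c k)) (sym (lookup-c-pos (suc (toℕ k)) (toℕ<n k)))
                    (state-edge 0 0 w (toℕ k) band-0-0 bw (≤-trans (toℕ<n k) (≤-reflexive (sym len))))
        stable : ∀ k → Stable n r (lookup c k)
        stable k rewrite lookup-c k = band-stable _ _ (in-band (toℕ k))
        not-more-stable : ¬ Stable n (suc r) (lookup c (pos n 0))
        not-more-stable = start-not-more-stable ∘ subst (Stable n (suc r)) (lookup-c-pos 0 z≤n)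

    targets-c : targets n c ≡ configs 0 0 w
    targets-c = trans (targets≡after c) (trans (applyUpTo-cong n (after c) visited (λ k k<n → lookup-c-pos (suc k) k<n))
                  (cong (applyUpTo visited) (sym len)))
      where
        visited : ℕ → Subset n
        visited k = configAt (state (suc k))

    lam-c : lam n r ℓ c ≡ μ
    lam-c rewrite moves-targets c w targets-c bw | segs-blocks (toList μ) = tabulate-lookupD μ (0 ∷ [])

  lam-surjective : ∀ μ → InT n r μ → ∃ λ c → InS n r v c × lam n r ℓ c ≡ μ
  lam-surjective μ μ∈T = FromSequence.c μ μ∈T , FromSequence.c∈S μ μ∈T , FromSequence.lam-c μ μ∈T

proposition3p8 : (n : ℕ) .{{_ : NonZero n}} → n % 2 ≡ 1 →
    (r : ℕ) → 0 < r → r < n / 2 → (ℓ : Fin n) →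
    let v = ε2 n ℓ (pos n (toℕ ℓ + r)) in
    (∀ c → InS n r v c → InT n r (lam n r ℓ c))
    × (∀ c c′ → InS n r v c → InS n r v c′ → lam n r ℓ c ≡ lam n r ℓ c′ → c ≡ c′)
    × (∀ μ → InT n r μ → ∃ λ c → InS n r v c × lam n r ℓ c ≡ μ)
proposition3p8 (suc m) _ (suc r') _ r<n/2 ℓ = lam-in-T , lam-injective , lam-surjective
  where
    2r<n : suc r' + suc r' < suc m
    2r<n = ≤-trans (n≤1+n _) (≤-trans (≤-reflexive (shape r')) (≤-trans (*-monoˡ-≤ 2 r<n/2) (m/n*n≤m (suc m) 2)))
      where shape : ∀ r' → suc (suc (suc r' + suc r')) ≡ suc (suc r') * 2
            shape = solve-∀
    open Circuits m r' ℓ 2r<n
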